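{- Let $P$ be a PPIP and let $X\subseteq P$ be a consistent subset. Then there exists a consistent subspace $S$ of $P$ with $X\subseteq S$.
   Context: $P$ is a poset of finite rank equipped with an inconsistency relation $\smile$ and a collinearity relation $C$. - An inconsistency relation is a symmetric binary relation satisfying: - (IC1) if $p\smile q$, then $p,q$ have no common upper bound; - (IC2) if $p\smile q$, $p\le p'$ and $q\le q'$, then $p'\smile q'$. - A subset is consistent if it contains no pair $p\smile q$. - A collinearity relation is a ternary relation invariant under permutations of its arguments, satisfying: - (CT1) if $C(p,q,r)$, then $p,q,r$ are pairwise incomparable; - (CT2) if $C(p,q,r)$, $p\le w$ and $q\le w$, then $r\le w$. $P$ is a PPIP if the following three axioms hold. - Regularity: if $C(p,q,r)$ and $r'\le r$ with $r'\not\le p$ and $r'\not\le q$, then there exist $p'\le p$ and $q'\le q$ with $C(p',q',r')$. - Weak Triangle: if $C(a,c,p)$ and $C(b,c,q)$ hold and $\{a,b,c,p,q\}$ is consistent, then at least one of the following holds: - (i) there is $x$ with $C(a,b,x)$ and $C(p,q,x)$, $\{a,b,c,p,q,x\}$ pairwise incomparable, and no collinear triples within $\{a,b,c,p,q,x\}$ other than $(a,c,p)$, $(b,c,q)$, $(a,b,x)$, $(p,q,x)$ and their permutations; - (ii) there is $a'\le a$ with $C(b,q,a')$; - (iii) $C(b,q,p)$; - (iv) there are $a'\le a$ and $p'\le p$ with $C(q,a',p')$; - (v) $q\le a$ or $q\le p$. - Consistent-Collinearity: whenever $C(p,q,r)$: - (CC1) $\{p,q,r\}$ is consistent; - (CC2)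 every $x\in P$ is consistent with at most one of $p,q,r$, or with all three. A subspace is an ideal $X$ (down-closed set) such that $p,q\in X$ and $C(p,q,r)$ imply $r\in X$. -}

module Defs where

open import Level using (Level; _⊔_; suc)
open import Data.Nat using (ℕ) renaming (_≤_ to _≤ℕ_)
open import Data.Fin using (Fin; inject₁) renaming (suc to fsuc)
open import Data.Product using (Σ; ∃; ∃-syntax; _×_; _,_)
open import Data.Sum using (_⊎_)
open import Data.List using (List; []; _∷_)
open import Data.List.Membership.Propositional using (_∈_)
open import Data.List.Relation.Unary.AllPairs using (AllPairs)
open import Relation.Nullary using (¬_)
open import Relation.Unary using (Pred)
open import Relation.Binary.PropositionalEquality using (_≡_)
open import Relation.Binary.Structures using (IsPartialOrder)

record PosetIC (a ℓ : Level) : Set (suc (a ⊔ ℓ)) where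
  infix 4 _≤_ _<_ _⌣_
  field
    Carrier : Set a
    _≤_ : Carrier → Carrier → Set ℓ
    isPartialOrder : IsPartialOrder _≡_ _≤_
    _⌣_ : Carrier → Carrier → Set ℓ
    C : Carrier → Carrier → Carrier → Set ℓ

  _<_ : Carrier → Carrier → Set (a ⊔ ℓ)
  p < q = p ≤ q × ¬ (p ≡ q)

  StrictChain : (k : ℕ) → (Fin (ℕ.suc k) → Carrier) → Set (a ⊔ ℓ)
  StrictChain k f = (i : Fin k) → f (inject₁ i) < f (fsuc i)

  FiniteRank : Set (a ⊔ ℓ)
  FiniteRank = ∃[ n ] (∀ k (f : Fin (ℕ.suc k) → Carrier) → StrictChain k f → k ≤ℕ n)

  Incomparable : Carrier → Carrier → Set ℓ
  Incomparable p q = ¬ (p ≤ q) × ¬ (q ≤ p)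

  Cons : Carrier → Carrier → Set ℓ
  Cons p q = ¬ (p ⌣ q)

  ConsistentList : List Carrier → Set (a ⊔ ℓ)
  ConsistentList = AllPairs Cons

  Consistent : ∀ {ℓX} → Pred Carrier ℓX → Set (a ⊔ ℓ ⊔ ℓX)
  Consistent X = ∀ {p q} → X p → X q → ¬ (p ⌣ q)

  SameTriple : Carrier → Carrier → Carrier → Carrier → Carrier → Carrier → Set a
  SameTriple u v w x y z =
    (u ≡ x × v ≡ y × w ≡ z) ⊎ (u ≡ x × v ≡ z × w ≡ y) ⊎
    (u ≡ y × v ≡ x × w ≡ z) ⊎ (u ≡ y × v ≡ z × w ≡ x) ⊎
    (u ≡ z × v ≡ x × w ≡ y) ⊎ (u ≡ z × v ≡ y × w ≡ x)

  IsInconsistency : Set (a ⊔ ℓ)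
  IsInconsistency =
    (∀ {p q} → p ⌣ q → q ⌣ p) ×
    (∀ {p q} → p ⌣ q → ¬ (∃[ w ] (p ≤ w × q ≤ w))) ×
    (∀ {p q p' q'} → p ⌣ q → p ≤ p' → q ≤ q' → p' ⌣ q')

  IsCollinearity : Set (a ⊔ ℓ)
  IsCollinearity =
    (∀ {p q r} → C p q r → C q p r) ×
    (∀ {p q r} → C p q r → C p r q) ×
    (∀ {p q r} → C p q r → Incomparable p q × Incomparable q r × Incomparable p r) ×
    (∀ {p q r w} → C p q r → p ≤ w → q ≤ w → r ≤ w)

  Regularity : Set (a ⊔ ℓ)
  Regularity = ∀ {p q r r'} → C p q r → r' ≤ r → ¬ (r' ≤ p) → ¬ (r' ≤ q) →
    ∃[ p' ] ∃[ q' ] (p' ≤ p × q' ≤ q × C p' q' r')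

  WeakTriangle : Set (a ⊔ ℓ)
  WeakTriangle = ∀ {a b c p q} → C a c p → C b c q →
    ConsistentList (a ∷ b ∷ c ∷ p ∷ q ∷ []) →
    (∃[ x ] (C a b x × C p q x ×
       AllPairs Incomparable (a ∷ b ∷ c ∷ p ∷ q ∷ x ∷ []) ×
       (∀ {u v w} → u ∈ (a ∷ b ∷ c ∷ p ∷ q ∷ x ∷ []) →
                    v ∈ (a ∷ b ∷ c ∷ p ∷ q ∷ x ∷ []) →
                    w ∈ (a ∷ b ∷ c ∷ p ∷ q ∷ x ∷ []) → C u v w →
          SameTriple u v w a c p ⊎ SameTriple u v w b c q ⊎
          SameTriple u v w a b x ⊎ SameTriple u v w p q x)))
    ⊎ (∃[ a' ] (a' ≤ a × C b q a'))
    ⊎ C b q p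
    ⊎ (∃[ a' ] ∃[ p' ] (a' ≤ a × p' ≤ p × C q a' p'))
    ⊎ (q ≤ a ⊎ q ≤ p)

  ConsistentCollinearity : Set (a ⊔ ℓ)
  ConsistentCollinearity = ∀ {p q r} → C p q r →
    ConsistentList (p ∷ q ∷ r ∷ []) ×
    (∀ x → (¬ (Cons x p × Cons x q) × ¬ (Cons x p × Cons x r) × ¬ (Cons x q × Cons x r))
           ⊎ (Cons x p × Cons x q × Cons x r))

  Ideal : ∀ {ℓX} → Pred Carrier ℓX → Set (a ⊔ ℓ ⊔ ℓX)
  Ideal S = ∀ {p q} → S q → p ≤ q → S p

  Subspace : ∀ {ℓX} → Pred Carrier ℓX → Set (a ⊔ ℓ ⊔ ℓX)
  Subspace S = Ideal S × (∀ {p q r} → S p → S q → C p q r → S r)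

record PPIP (a ℓ : Level) : Set (suc (a ⊔ ℓ)) where
  field
    structure : PosetIC a ℓ
  open PosetIC structure public
  field
    finiteRank : FiniteRank
    inconsistency : IsInconsistency
    collinearity : IsCollinearity
    regularity : Regularity
    weakTriangle : WeakTriangle
    consistentCollinearity : ConsistentCollinearity

module Submission where

-- Idea: take the double orthogonal of X with respect to consistency.  For a
-- subset Y write  Y ᗮ  for the set of points consistent with every point of Y.
-- Then
--   * every orthogonal Y ᗮ is a subspace: it is down-closed by (IC2), and it is
--     closed under collinearity by (CC2), since a point consistent with two
--     points of a line is consistent with the third;
--   * Y ⊆ Y ᗮ ᗮ by symmetry of the inconsistency relation;
--   * Y is consistent exactly when Y ⊆ Y ᗮ, and then Y ᗮ ᗮ ⊆ Y ᗮ by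
--     antitonicity of ᗮ, which makes Y ᗮ ᗮ consistent as well.

open import Defs
open import Level using (Level; _⊔_)
open import Data.Product using (Σ; _×_; _,_; proj₁; proj₂)
open import Data.Sum using (inj₁; inj₂)
open import Relation.Unary using (Pred; _⊆_)
open import Relation.Binary.Definitions using (Reflexive; Symmetric)
open import Relation.Binary.Structures using (IsPartialOrder)

module Orthogonality {a ℓ : Level} (P : PosetIC a ℓ) where
  open PosetIC P

  _ᗮ : ∀ {ℓY} → Pred Carrier ℓY → Pred Carrier (a ⊔ ℓ ⊔ ℓY)
  (Y ᗮ) p = ∀ {y} → Y y → Cons p y

  ᗮ-antitone : ∀ {ℓY ℓZ} {Y : Pred Carrier ℓY} {Z : Pred Carrier ℓZ} →
    Y ⊆ Z → Z ᗮ ⊆ Y ᗮ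
  ᗮ-antitone Y⊆Z p∈Zᗮ y∈Y = p∈Zᗮ (Y⊆Z y∈Y)

  consistent⇒⊆ᗮ : ∀ {ℓY} {Y : Pred Carrier ℓY} → Consistent Y → Y ⊆ Y ᗮ
  consistent⇒⊆ᗮ consY p∈Y q∈Y = consY p∈Y q∈Y

  ⊆ᗮᗮ : Symmetric _⌣_ → ∀ {ℓY} {Y : Pred Carrier ℓY} → Y ⊆ Y ᗮ ᗮ
  ⊆ᗮᗮ sym⌣ p∈Y q∈Yᗮ p⌣q = q∈Yᗮ p∈Y (sym⌣ p⌣q)

  -- The double orthogonal of a consistent set is consistent: it lies inside
  -- the single orthogonal, whose points are consistent with all of Y ᗮ ᗮ.
  ᗮᗮ-consistent : Symmetric _⌣_ → ∀ {ℓY} {Y : Pred Carrier ℓY} →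
    Consistent Y → Consistent (Y ᗮ ᗮ)
  ᗮᗮ-consistent sym⌣ consY p∈Yᗮᗮ q∈Yᗮᗮ p⌣q =
    q∈Yᗮᗮ (ᗮ-antitone (consistent⇒⊆ᗮ consY) p∈Yᗮᗮ) (sym⌣ p⌣q)

  ᗮ-ideal : Reflexive _≤_ →
    (∀ {p q p' q'} → p ⌣ q → p ≤ p' → q ≤ q' → p' ⌣ q') →
    ∀ {ℓY} {Y : Pred Carrier ℓY} → Ideal (Y ᗮ)
  ᗮ-ideal refl≤ mono⌣ q∈Yᗮ p≤q y∈Y p⌣y = q∈Yᗮ y∈Y (mono⌣ p⌣y p≤q refl≤)

  -- Orthogonals are closed under collinearity: by (CC2) a point y consistent
  -- with p and q, where C p q r, is consistent with all of p, q, r.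
  ᗮ-collinear-closed : Symmetric _⌣_ → ConsistentCollinearity →
    ∀ {ℓY} {Y : Pred Carrier ℓY} {p q r} →
    (Y ᗮ) p → (Y ᗮ) q → C p q r → (Y ᗮ) r
  ᗮ-collinear-closed sym⌣ cc p∈Yᗮ q∈Yᗮ Cpqr {y} y∈Y r⌣y
    with proj₂ (cc Cpqr) y
  ... | inj₁ (notBoth-p-q , _) =
          notBoth-p-q ((λ y⌣p → p∈Yᗮ y∈Y (sym⌣ y⌣p)) ,
                       (λ y⌣q → q∈Yᗮ y∈Y (sym⌣ y⌣q)))
  ... | inj₂ (_ , _ , y-cons-r) = y-cons-r (sym⌣ r⌣y)

ᗮ-subspace : ∀ {a ℓ ℓY} (P : PPIP a ℓ) {Y : Pred (PPIP.Carrier P) ℓY} →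
  PPIP.Subspace P (Orthogonality._ᗮ (PPIP.structure P) Y)
ᗮ-subspace P =
  ᗮ-ideal (IsPartialOrder.refl isPartialOrder) (proj₂ (proj₂ inconsistency)) ,
  ᗮ-collinear-closed (proj₁ inconsistency) consistentCollinearity
  where
  open PPIP P
  open Orthogonality structure

lemma2p9 : ∀ {a ℓ ℓX} (P : PPIP a ℓ) (X : Pred (PPIP.Carrier P) ℓX) →
    PPIP.Consistent P X →
    Σ (Pred (PPIP.Carrier P) (a ⊔ ℓ ⊔ ℓX))
    (λ S → PPIP.Subspace P S × PPIP.Consistent P S × X ⊆ S)
lemma2p9 P X consX =
  X ᗮ ᗮ , ᗮ-subspace P , ᗮᗮ-consistent sym⌣ consX , ⊆ᗮᗮ sym⌣
  where
  open PPIP P using (structure; inconsistency)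
  open Orthogonality structure
  sym⌣ = proj₁ inconsistency
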